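{- If $G$ is totally rigid and acyclic, then up to renaming of the non-terminals $G=\langle\{\alpha_0,\ldots,\alpha_n\},\Sigma,\alpha_0,P\rangle$ with $L(G)=\{\alpha_0\{\alpha_0\mapsto t_0\}\cdots\{\alpha_n\mapsto t_n\}\mid \alpha_i\rightarrow t_i\in P\}$.
   Context: A regular tree grammar $\langle N,\Sigma,\tau,P\rangle$ has non-terminals $N$, signature $\Sigma$, start symbol $\tau$ and productions $\beta\to t$ with $\beta\in N$ and $t$ a term over $\Sigma$ and $N$. It is totally rigid if all non-terminals are rigid: in a derivation of a term $t$, whenever the same non-terminal occurs at positions $p$ and $q$ in intermediate terms, $t|_p=t|_q$. It is acyclic if no non-terminal $\beta$ derives a term containing $\beta$. $L(G)$ is the set of variable-free terms derivable from the start symbol under the rigidity condition. $t\{\alpha\mapsto s\}$ denotes substitution of $s$ for $\alpha$ in $t$.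
   Formalization: Besides acyclicity, G is assumed to have at least one production in P for every one of its non-terminals. The statement above fails without it. -}

module Defs where

open import Data.Nat using (ℕ; zero; suc)
open import Data.Fin using (Fin; zero; suc; _≟_)
open import Data.Vec using (Vec; []; _∷_)
open import Data.List using (List; []; _∷_; foldl)
open import Data.Maybe using (Maybe; just; nothing)
open import Data.Product using (Σ; Σ-syntax; ∃; ∃-syntax; _×_; _,_)
open import Data.Empty using (⊥)
open import Data.List.Membership.Propositional using (_∈_)
open import Relation.Nullary using (yes; no; ¬_)
open import Relation.Binary.PropositionalEquality using (_≡_)
open import Relation.Binary.Construct.Closure.Transitive using (TransClosure)

record Signature : Set₁ where
  field
    Sym   : Set
    arity : Sym → ℕ
open Signature public

data Term (Sg : Signature) (N : Set) : Set where
  var : N → Term Sg N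
  fun : (f : Sym Sg) → Vec (Term Sg N) (arity Sg f) → Term Sg N

-- A regular tree grammar ⟨N, Σ, τ, P⟩; the non-terminals are Fin k
-- (any finite set, up to renaming), P a finite set of productions β → t.
record Grammar (Sg : Signature) : Set where
  field
    k     : ℕ
    start : Fin k
    prods : List (Fin k × Term Sg (Fin k))
open Grammar public

NT : ∀ {Sg} → Grammar Sg → Set
NT G = Fin (k G)

Tm : ∀ {Sg} → Grammar Sg → Set
Tm {Sg} G = Term Sg (NT G)

-- Positions are lists of argument indices (0-based).
Pos : Set
Pos = List ℕ

module _ {Sg : Signature} {N : Set} where

  mutual
    _at_ : Term Sg N → Pos → Maybe (Term Sg N)
    t at [] = just t
    var x at (i ∷ p) = nothing
    fun f ts at (i ∷ p) = atArgs ts i p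

    atArgs : ∀ {m} → Vec (Term Sg N) m → ℕ → Pos → Maybe (Term Sg N)
    atArgs [] i p = nothing
    atArgs (t ∷ ts) zero p = t at p
    atArgs (t ∷ ts) (suc i) p = atArgs ts i p

  mutual
    -- t[s]_p : replace the subterm at position p by s (identity if p invalid)
    replaceAt : Term Sg N → Pos → Term Sg N → Term Sg N
    replaceAt t [] s = s
    replaceAt (var x) (i ∷ p) s = var x
    replaceAt (fun f ts) (i ∷ p) s = fun f (replaceArgs ts i p s)

    replaceArgs : ∀ {m} → Vec (Term Sg N) m → ℕ → Pos → Term Sg N → Vec (Term Sg N) m
    replaceArgs [] i p s = []
    replaceArgs (t ∷ ts) zero p s = replaceAt t p s ∷ ts
    replaceArgs (t ∷ ts) (suc i) p s = t ∷ replaceArgs ts i p s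

  mutual
    data Occurs (β : N) : Term Sg N → Set where
      here : Occurs β (var β)
      under : ∀ {f ts} → OccursArgs β ts → Occurs β (fun f ts)

    data OccursArgs (β : N) : ∀ {m} → Vec (Term Sg N) m → Set where
      head : ∀ {m t} {ts : Vec (Term Sg N) m} → Occurs β t → OccursArgs β (t ∷ ts)
      tail : ∀ {m t} {ts : Vec (Term Sg N) m} → OccursArgs β ts → OccursArgs β (t ∷ ts)

  Ground : Term Sg N → Set
  Ground t = ∀ β → ¬ Occurs β t

module _ {Sg : Signature} {k : ℕ} where

  mutual
    _[_↦_] : Term Sg (Fin k) → Fin k → Term Sg (Fin k) → Term Sg (Fin k)
    var x [ α ↦ s ] with x ≟ α
    ... | yes _ = s
    ... | no _ = var x
    fun f ts [ α ↦ s ] = fun f (substArgs ts α s)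

    substArgs : ∀ {m} → Vec (Term Sg (Fin k)) m → Fin k → Term Sg (Fin k) → Vec (Term Sg (Fin k)) m
    substArgs [] α s = []
    substArgs (t ∷ ts) α s = (t [ α ↦ s ]) ∷ substArgs ts α s

  substSeq : Term Sg (Fin k) → List (Fin k × Term Sg (Fin k)) → Term Sg (Fin k)
  substSeq = foldl (λ t αs → let (α , s) = αs in t [ α ↦ s ])

module _ {Sg : Signature} (G : Grammar Sg) where

  data Step (s : Tm G) : Tm G → Set where
    step : (p : Pos) (β : NT G) (r : Tm G) →
           (β , r) ∈ prods G → s at p ≡ just (var β) →
           Step s (replaceAt s p r)

  record Derivation (t : Tm G) : Set where
    field
      len     : ℕ
      terms   : Fin (suc len) → Tm G
      initial : terms zero ≡ var (start G)
      steps   : (i : Fin len) → Step (terms (Data.Fin.inject₁ i)) (terms (suc i))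
      final   : terms (Data.Fin.fromℕ len) ≡ t

  TotallyRigid : ∀ {t} → Derivation t → Set
  TotallyRigid {t} d = ∀ (i j : Fin (suc (Derivation.len d))) (p q : Pos) (β : NT G) →
    Derivation.terms d i at p ≡ just (var β) →
    Derivation.terms d j at q ≡ just (var β) →
    t at p ≡ t at q

  L : Tm G → Set
  L t = Ground t × Σ[ d ∈ Derivation t ] TotallyRigid d

  Acyclic : Set
  Acyclic = ∀ (β : NT G) (s : Tm G) → TransClosure Step (var β) s → ¬ Occurs β s

{-# OPTIONS --safe #-}
-- Acyclicity makes "γ occurs in a rule of β" a well-founded relation, so the non-terminals can be
-- enumerated as α₀ = τ, α₁, …, αₙ such that, for every β occurring in a sentential form, the
-- non-terminals in the rules of β come after β. Given one rule αᵢ → tᵢ per non-terminal, the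
-- sequential substitution σ(β) = β{α₀ ↦ t₀}⋯{αₙ ↦ tₙ} then satisfies σ(β) = tᵢ{σ} for such β = αᵢ, so
-- σ(τ) is ground and is derived rigidly by always expanding β into its chosen rule, with every
-- intermediate term s satisfying s{σ} = σ(τ). Conversely, in a rigid derivation of a ground term t,
-- every non-terminal that occurs is expanded at some step; choosing for it the rule used there,
-- rigidity and induction along the enumeration from the back show that t has σ(β) at every position
-- where β occurs, in particular t = σ(τ).
module Submission where

open import Defs
open import Data.Nat as ℕ using (ℕ; zero; suc; _∸_; z≤n; s≤s)
open import Data.Nat.Properties as ℕ using (<-cmp; <-irrefl; <-asym; ≤-refl)
open import Data.Fin using (Fin; zero; suc; _<_; _≤_; toℕ; fromℕ; fromℕ<; inject₁; punchOut; _≟_)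
open import Data.Fin.Properties
  using (toℕ-injective; toℕ<n; toℕ-fromℕ<; any?; pigeonhole; punchOut-injective; injective⇒≤; ≤fromℕ)
open import Data.Fin.Induction using (<-weakInduction; <-weakInduction-startingFrom; >-weakInduction; >-wellFounded)
open import Data.Vec using (Vec; []; _∷_)
open import Data.List using (List; []; _∷_; _++_; length; filter; map; allFin; tabulate)
open import Data.List.Properties
  using (length-tabulate; foldl-++; filter-notAll; filter-none; map-cong-local; tabulate-cong)
open import Data.List.Extrema ℕ.≤-totalOrder using (max; max≤v⁺; v≤max⁺)
open import Data.List.Membership.Propositional using (_∈_; find; lose)
open import Data.List.Membership.Propositional.Properties using (∈-filter⁺; ∈-filter⁻; ∈-allFin)
open import Data.List.Relation.Unary.Any as Any using (here; there)
import Data.List.Relation.Unary.Any.Properties as Any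
import Data.List.Relation.Unary.All as All
import Data.List.Relation.Unary.All.Properties as All
open import Data.Maybe using (just)
open import Data.Maybe.Properties using (just-injective)
open import Data.Product using (Σ-syntax; ∃-syntax; ∃₂; _×_; _,_; proj₁; proj₂)
open import Data.Sum using (inj₁; inj₂)
open import Function using (_∘_)
open import Function.Bundles using (_↔_; Inverse; _⇔_; mk⇔; mk↔ₛ′)
open import Function.Definitions using (Injective)
open import Relation.Nullary using (Dec; yes; no; ¬_; contradiction)
open import Relation.Nullary.Decidable using (map′; _⊎-dec_; _×-dec_)
open import Relation.Binary.Definitions using (DecidableEquality; Decidable; tri<; tri≈; tri>)
open import Relation.Binary.PropositionalEquality
open import Relation.Binary.Construct.Closure.Transitive using (TransClosure; [_]; _∷_; _∷ʳ_)
open import Relation.Binary.Construct.Closure.ReflexiveTransitive using (Star; ε; _◅_; _◅◅_; gmap)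
import Relation.Binary.Construct.On as On
import Induction.WellFounded as WF

module _ {Sg : Signature} {N : Set} where

  mutual
    sub : (N → Term Sg N) → Term Sg N → Term Sg N
    sub σ (var x)    = σ x
    sub σ (fun f ts) = fun f (subArgs σ ts)

    subArgs : ∀ {m} → (N → Term Sg N) → Vec (Term Sg N) m → Vec (Term Sg N) m
    subArgs σ []       = []
    subArgs σ (t ∷ ts) = sub σ t ∷ subArgs σ ts

  mutual
    sub-var : ∀ (t : Term Sg N) → sub var t ≡ t
    sub-var (var x)    = refl
    sub-var (fun f ts) = cong (fun f) (subArgs-var ts)

    subArgs-var : ∀ {m} (ts : Vec (Term Sg N) m) → subArgs var ts ≡ ts
    subArgs-var []       = refl
    subArgs-var (t ∷ ts) = cong₂ _∷_ (sub-var t) (subArgs-var ts)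

  mutual
    sub-cong : ∀ {σ τ} (t : Term Sg N) → (∀ x → Occurs x t → σ x ≡ τ x) → sub σ t ≡ sub τ t
    sub-cong (var x)    σ≗τ = σ≗τ x here
    sub-cong (fun f ts) σ≗τ = cong (fun f) (subArgs-cong ts (λ x → σ≗τ x ∘ under))

    subArgs-cong : ∀ {σ τ m} (ts : Vec (Term Sg N) m) → (∀ x → OccursArgs x ts → σ x ≡ τ x) →
                   subArgs σ ts ≡ subArgs τ ts
    subArgs-cong []       σ≗τ = refl
    subArgs-cong (t ∷ ts) σ≗τ =
      cong₂ _∷_ (sub-cong t (λ x → σ≗τ x ∘ head)) (subArgs-cong ts (λ x → σ≗τ x ∘ tail))

  mutual
    sub-sub : ∀ σ τ (t : Term Sg N) → sub σ (sub τ t) ≡ sub (sub σ ∘ τ) t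
    sub-sub σ τ (var x)    = refl
    sub-sub σ τ (fun f ts) = cong (fun f) (subArgs-subArgs σ τ ts)

    subArgs-subArgs : ∀ σ τ {m} (ts : Vec (Term Sg N) m) → subArgs σ (subArgs τ ts) ≡ subArgs (sub σ ∘ τ) ts
    subArgs-subArgs σ τ []       = refl
    subArgs-subArgs σ τ (t ∷ ts) = cong₂ _∷_ (sub-sub σ τ t) (subArgs-subArgs σ τ ts)

  mutual
    Occurs-sub⁻ : ∀ σ (t : Term Sg N) {x} → Occurs x (sub σ t) → ∃[ y ] (Occurs y t × Occurs x (σ y))
    Occurs-sub⁻ σ (var y)    o         = y , here , o
    Occurs-sub⁻ σ (fun f ts) (under o) with y , o₁ , o₂ ← OccursArgs-subArgs⁻ σ ts o = y , under o₁ , o₂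

    OccursArgs-subArgs⁻ : ∀ σ {m} (ts : Vec (Term Sg N) m) {x} → OccursArgs x (subArgs σ ts) →
                          ∃[ y ] (OccursArgs y ts × Occurs x (σ y))
    OccursArgs-subArgs⁻ σ (t ∷ ts) (head o) with y , o₁ , o₂ ← Occurs-sub⁻ σ t o = y , head o₁ , o₂
    OccursArgs-subArgs⁻ σ (t ∷ ts) (tail o) with y , o₁ , o₂ ← OccursArgs-subArgs⁻ σ ts o = y , tail o₁ , o₂

  Ground-sub : ∀ σ (t : Term Sg N) → (∀ y → Occurs y t → Ground (σ y)) → Ground (sub σ t)
  Ground-sub σ t ground x o with y , o₁ , o₂ ← Occurs-sub⁻ σ t o = ground y o₁ x o₂

  module _ (_≟N_ : DecidableEquality N) where
    mutual
      occurs? : ∀ x (t : Term Sg N) → Dec (Occurs x t)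
      occurs? x (var y) with y ≟N x
      ... | yes refl = yes here
      ... | no y≢x   = no λ { here → y≢x refl }
      occurs? x (fun f ts) = map′ under (λ { (under o) → o }) (occursArgs? x ts)

      occursArgs? : ∀ x {m} (ts : Vec (Term Sg N) m) → Dec (OccursArgs x ts)
      occursArgs? x []       = no λ ()
      occursArgs? x (t ∷ ts) =
        map′ (λ { (inj₁ o) → head o ; (inj₂ o) → tail o })
             (λ { (head o) → inj₁ o ; (tail o) → inj₂ o })
             (occurs? x t ⊎-dec occursArgs? x ts)

  mutual
    at⇒Occurs : ∀ (s : Term Sg N) p {x} → s at p ≡ just (var x) → Occurs x s
    at⇒Occurs s          []      refl = here
    at⇒Occurs (fun f ts) (i ∷ p) e    = under (atArgs⇒OccursArgs ts i p e)

    atArgs⇒OccursArgs : ∀ {m} (ts : Vec (Term Sg N) m) i p {x} → atArgs ts i p ≡ just (var x) → OccursArgs x ts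
    atArgs⇒OccursArgs (t ∷ ts) zero    p e = head (at⇒Occurs t p e)
    atArgs⇒OccursArgs (t ∷ ts) (suc i) p e = tail (atArgs⇒OccursArgs ts i p e)

  mutual
    Occurs⇒at : ∀ {x} {s : Term Sg N} → Occurs x s → ∃[ p ] (s at p ≡ just (var x))
    Occurs⇒at here      = [] , refl
    Occurs⇒at (under o) with i , p , e ← OccursArgs⇒atArgs o = i ∷ p , e

    OccursArgs⇒atArgs : ∀ {x m} {ts : Vec (Term Sg N) m} → OccursArgs x ts → ∃₂ λ i p → atArgs ts i p ≡ just (var x)
    OccursArgs⇒atArgs (head o) with p , e ← Occurs⇒at o = zero , p , e
    OccursArgs⇒atArgs (tail o) with i , p , e ← OccursArgs⇒atArgs o = suc i , p , e

  mutual
    at-++ : ∀ (s : Term Sg N) p q {w} → s at p ≡ just w → s at (p ++ q) ≡ w at q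
    at-++ s          []      q refl = refl
    at-++ (fun f ts) (i ∷ p) q e    = atArgs-++ ts i p q e

    atArgs-++ : ∀ {m} (ts : Vec (Term Sg N) m) i p q {w} → atArgs ts i p ≡ just w → atArgs ts i (p ++ q) ≡ w at q
    atArgs-++ (t ∷ ts) zero    p q e = at-++ t p q e
    atArgs-++ (t ∷ ts) (suc i) p q e = atArgs-++ ts i p q e

  mutual
    at-replaceAt : ∀ (s : Term Sg N) p {w} r → s at p ≡ just w → replaceAt s p r at p ≡ just r
    at-replaceAt s          []      r e = refl
    at-replaceAt (fun f ts) (i ∷ p) r e = atArgs-replaceArgs ts i p r e

    atArgs-replaceArgs : ∀ {m} (ts : Vec (Term Sg N) m) i p {w} r → atArgs ts i p ≡ just w →
                         atArgs (replaceArgs ts i p r) i p ≡ just r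
    atArgs-replaceArgs (t ∷ ts) zero    p r e = at-replaceAt t p r e
    atArgs-replaceArgs (t ∷ ts) (suc i) p r e = atArgs-replaceArgs ts i p r e

  mutual
    Occurs-replaceAt⁺ : ∀ (s : Term Sg N) p {w x} r → s at p ≡ just w → Occurs x r → Occurs x (replaceAt s p r)
    Occurs-replaceAt⁺ s          []      r e o = o
    Occurs-replaceAt⁺ (fun f ts) (i ∷ p) r e o = under (OccursArgs-replaceArgs⁺ ts i p r e o)

    OccursArgs-replaceArgs⁺ : ∀ {m} (ts : Vec (Term Sg N) m) i p {w x} r → atArgs ts i p ≡ just w → Occurs x r →
                              OccursArgs x (replaceArgs ts i p r)
    OccursArgs-replaceArgs⁺ (t ∷ ts) zero    p r e o = head (Occurs-replaceAt⁺ t p r e o)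
    OccursArgs-replaceArgs⁺ (t ∷ ts) (suc i) p r e o = tail (OccursArgs-replaceArgs⁺ ts i p r e o)

  -- Variable positions are leaves, so two of them are either equal or disjoint.
  mutual
    replaceAt-preserves-var : ∀ (s : Term Sg N) p p' {x y} r → s at p ≡ just (var x) → s at p' ≡ just (var y) →
                              x ≢ y → replaceAt s p' r at p ≡ just (var x)
    replaceAt-preserves-var s          []      []       r refl refl x≢y = contradiction refl x≢y
    replaceAt-preserves-var (fun f ts) (i ∷ p) (i' ∷ p') r e    e'   x≢y =
      replaceArgs-preserves-var ts i p i' p' r e e' x≢y

    replaceArgs-preserves-var : ∀ {m} (ts : Vec (Term Sg N) m) i p i' p' {x y} r →
                                atArgs ts i p ≡ just (var x) → atArgs ts i' p' ≡ just (var y) → x ≢ y →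
                                atArgs (replaceArgs ts i' p' r) i p ≡ just (var x)
    replaceArgs-preserves-var (t ∷ ts) zero    p zero     p' r e e' x≢y = replaceAt-preserves-var t p p' r e e' x≢y
    replaceArgs-preserves-var (t ∷ ts) zero    p (suc i') p' r e e' x≢y = e
    replaceArgs-preserves-var (t ∷ ts) (suc i) p zero     p' r e e' x≢y = e
    replaceArgs-preserves-var (t ∷ ts) (suc i) p (suc i') p' r e e' x≢y =
      replaceArgs-preserves-var ts i p i' p' r e e' x≢y

  mutual
    at-sub : ∀ σ (s : Term Sg N) p {w} → s at p ≡ just w → sub σ s at p ≡ just (sub σ w)
    at-sub σ s          []      refl = refl
    at-sub σ (fun f ts) (i ∷ p) e    = atArgs-subArgs σ ts i p e

    atArgs-subArgs : ∀ σ {m} (ts : Vec (Term Sg N) m) i p {w} → atArgs ts i p ≡ just w →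
                     atArgs (subArgs σ ts) i p ≡ just (sub σ w)
    atArgs-subArgs σ (t ∷ ts) zero    p e = at-sub σ t p e
    atArgs-subArgs σ (t ∷ ts) (suc i) p e = atArgs-subArgs σ ts i p e

  mutual
    sub-replaceAt : ∀ σ (s : Term Sg N) p {w} r → s at p ≡ just w → sub σ r ≡ sub σ w →
                    sub σ (replaceAt s p r) ≡ sub σ s
    sub-replaceAt σ s          []      r refl eq = eq
    sub-replaceAt σ (fun f ts) (i ∷ p) r e    eq = cong (fun f) (subArgs-replaceArgs σ ts i p r e eq)

    subArgs-replaceArgs : ∀ σ {m} (ts : Vec (Term Sg N) m) i p {w} r → atArgs ts i p ≡ just w → sub σ r ≡ sub σ w →
                          subArgs σ (replaceArgs ts i p r) ≡ subArgs σ ts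
    subArgs-replaceArgs σ (t ∷ ts) zero    p r e eq = cong (_∷ subArgs σ ts) (sub-replaceAt σ t p r e eq)
    subArgs-replaceArgs σ (t ∷ ts) (suc i) p r e eq = cong (sub σ t ∷_) (subArgs-replaceArgs σ ts i p r e eq)

  -- u ≽ s : u matches s non-linearly, i.e. different occurrences of one variable of s may correspond
  -- to different subterms of u.
  mutual
    data _≽_ : Term Sg N → Term Sg N → Set where
      var : ∀ {u x} → u ≽ var x
      fun : ∀ {f us ss} → us ≽* ss → fun f us ≽ fun f ss

    data _≽*_ : ∀ {m} → Vec (Term Sg N) m → Vec (Term Sg N) m → Set where
      []  : [] ≽* []
      _∷_ : ∀ {m u s} {us ss : Vec (Term Sg N) m} → u ≽ s → us ≽* ss → (u ∷ us) ≽* (s ∷ ss)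

  mutual
    ≽-refl : ∀ (t : Term Sg N) → t ≽ t
    ≽-refl (var x)    = var
    ≽-refl (fun f ts) = fun (≽*-refl ts)

    ≽*-refl : ∀ {m} (ts : Vec (Term Sg N) m) → ts ≽* ts
    ≽*-refl []       = []
    ≽*-refl (t ∷ ts) = ≽-refl t ∷ ≽*-refl ts

  mutual
    ≽-replaceAt⁻ : ∀ {u} (s : Term Sg N) p {x} r → s at p ≡ just (var x) → u ≽ replaceAt s p r → u ≽ s
    ≽-replaceAt⁻ s          []      r refl u≽ = var
    ≽-replaceAt⁻ (fun f ts) (i ∷ p) r e (fun us≽) = fun (≽*-replaceArgs⁻ ts i p r e us≽)

    ≽*-replaceArgs⁻ : ∀ {m} {us} (ts : Vec (Term Sg N) m) i p {x} r → atArgs ts i p ≡ just (var x) →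
                      us ≽* replaceArgs ts i p r → us ≽* ts
    ≽*-replaceArgs⁻ (t ∷ ts) zero    p r e (u≽ ∷ us≽) = ≽-replaceAt⁻ t p r e u≽ ∷ us≽
    ≽*-replaceArgs⁻ (t ∷ ts) (suc i) p r e (u≽ ∷ us≽) = u≽ ∷ ≽*-replaceArgs⁻ ts i p r e us≽

  mutual
    ≽-at : ∀ {u s : Term Sg N} p {w} → u ≽ s → s at p ≡ just w → ∃[ w' ] (u at p ≡ just w' × w' ≽ w)
    ≽-at []      u≽s      refl = _ , refl , u≽s
    ≽-at (i ∷ p) (fun us≽) e    = ≽*-atArgs i p us≽ e

    ≽*-atArgs : ∀ {m} {us ss : Vec (Term Sg N) m} i p {w} → us ≽* ss → atArgs ss i p ≡ just w →
                ∃[ w' ] (atArgs us i p ≡ just w' × w' ≽ w)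
    ≽*-atArgs zero    p (u≽ ∷ us≽) e = ≽-at p u≽ e
    ≽*-atArgs (suc i) p (u≽ ∷ us≽) e = ≽*-atArgs i p us≽ e

  mutual
    ≽⇒≡sub : ∀ σ {u s : Term Sg N} → u ≽ s →
             (∀ q y → s at q ≡ just (var y) → u at q ≡ just (σ y)) → u ≡ sub σ s
    ≽⇒≡sub σ (var {x = x}) agree = just-injective (agree [] x refl)
    ≽⇒≡sub σ (fun us≽)     agree = cong (fun _) (≽*⇒≡subArgs σ us≽ λ i q → agree (i ∷ q))

    ≽*⇒≡subArgs : ∀ σ {m} {us ss : Vec (Term Sg N) m} → us ≽* ss →
                  (∀ i q y → atArgs ss i q ≡ just (var y) → atArgs us i q ≡ just (σ y)) → us ≡ subArgs σ ss
    ≽*⇒≡subArgs σ []         agree = refl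
    ≽*⇒≡subArgs σ (u≽ ∷ us≽) agree =
      cong₂ _∷_ (≽⇒≡sub σ u≽ (agree zero)) (≽*⇒≡subArgs σ us≽ (agree ∘ suc))

module _ {Sg : Signature} {k : ℕ} where

  mutual
    [↦]≡sub : ∀ (t : Term Sg (Fin k)) a s → t [ a ↦ s ] ≡ sub (λ x → var x [ a ↦ s ]) t
    [↦]≡sub (var x)    a s = refl
    [↦]≡sub (fun f ts) a s = cong (fun f) (substArgs≡subArgs ts a s)

    substArgs≡subArgs : ∀ {m} (ts : Vec (Term Sg (Fin k)) m) a s →
                        substArgs ts a s ≡ subArgs (λ x → var x [ a ↦ s ]) ts
    substArgs≡subArgs []       a s = refl
    substArgs≡subArgs (t ∷ ts) a s = cong₂ _∷_ ([↦]≡sub t a s) (substArgs≡subArgs ts a s)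

  var-[↦]-self : ∀ a (s : Term Sg (Fin k)) → var a [ a ↦ s ] ≡ s
  var-[↦]-self a s with a ≟ a
  ... | yes _  = refl
  ... | no a≢a = contradiction refl a≢a

  var-[↦]-other : ∀ {x a} (s : Term Sg (Fin k)) → x ≢ a → var x [ a ↦ s ] ≡ var x
  var-[↦]-other {x} {a} s x≢a with x ≟ a
  ... | yes x≡a = contradiction x≡a x≢a
  ... | no _    = refl

  [↦]-fresh : ∀ (t : Term Sg (Fin k)) {a} s → ¬ Occurs a t → t [ a ↦ s ] ≡ t
  [↦]-fresh t {a} s a∉t = begin
    t [ a ↦ s ]                      ≡⟨ [↦]≡sub t a s ⟩
    sub (λ x → var x [ a ↦ s ]) t    ≡⟨ sub-cong t (λ x x∈t → var-[↦]-other s λ { refl → a∉t x∈t }) ⟩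
    sub var t                        ≡⟨ sub-var t ⟩
    t                                ∎
    where open ≡-Reasoning

  substSeq≡sub : ∀ (t : Term Sg (Fin k)) L → substSeq t L ≡ sub (λ x → substSeq (var x) L) t
  substSeq≡sub t []            = sym (sub-var t)
  substSeq≡sub t ((a , s) ∷ L) = begin
    substSeq (t [ a ↦ s ]) L                    ≡⟨ substSeq≡sub (t [ a ↦ s ]) L ⟩
    sub (σ L) (t [ a ↦ s ])                     ≡⟨ cong (sub (σ L)) ([↦]≡sub t a s) ⟩
    sub (σ L) (sub (λ x → var x [ a ↦ s ]) t)   ≡⟨ sub-sub (σ L) _ t ⟩
    sub (sub (σ L) ∘ (λ x → var x [ a ↦ s ])) t ≡⟨ sub-cong t (λ x _ → substSeq≡sub (var x [ a ↦ s ]) L) ⟨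
    sub (σ ((a , s) ∷ L)) t                     ∎
    where
    open ≡-Reasoning
    σ : List (Fin k × Term Sg (Fin k)) → Fin k → Term Sg (Fin k)
    σ L x = substSeq (var x) L

  Fresh : List (Fin k × Term Sg (Fin k)) → Term Sg (Fin k) → Set
  Fresh L t = ∀ {b s} → (b , s) ∈ L → ¬ Occurs b t

  substSeq-fresh : ∀ (t : Term Sg (Fin k)) L → Fresh L t → substSeq t L ≡ t
  substSeq-fresh t []            fresh = refl
  substSeq-fresh t ((a , s) ∷ L) fresh = begin
    substSeq (t [ a ↦ s ]) L ≡⟨ cong (λ u → substSeq u L) ([↦]-fresh t s (fresh (here refl))) ⟩
    substSeq t L             ≡⟨ substSeq-fresh t L (fresh ∘ there) ⟩
    t                        ∎
    where open ≡-Reasoning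

  substSeq-var-unfold : ∀ a (t : Term Sg (Fin k)) A B → Fresh A (var a) → Fresh A t → ¬ Occurs a t →
                        substSeq (var a) (A ++ (a , t) ∷ B) ≡ substSeq t (A ++ (a , t) ∷ B)
  substSeq-var-unfold a t A B A#a A#t a∉t = begin
    substSeq (var a) (A ++ (a , t) ∷ B)         ≡⟨ foldl-++ _ (var a) A _ ⟩
    substSeq (substSeq (var a) A) ((a , t) ∷ B) ≡⟨ cong (λ u → substSeq u rest) (substSeq-fresh (var a) A A#a) ⟩
    substSeq (var a [ a ↦ t ]) B                ≡⟨ cong (λ u → substSeq u B) (var-[↦]-self a t) ⟩
    substSeq t B                                ≡⟨ cong (λ u → substSeq u B) ([↦]-fresh t t a∉t) ⟨
    substSeq t ((a , t) ∷ B)                    ≡⟨ cong (λ u → substSeq u rest) (substSeq-fresh t A A#t) ⟨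
    substSeq (substSeq t A) ((a , t) ∷ B)       ≡⟨ foldl-++ _ t A _ ⟨
    substSeq t (A ++ (a , t) ∷ B)               ∎
    where
    open ≡-Reasoning
    rest = (a , t) ∷ B

tabulate-split : ∀ {A : Set} {m} (f : Fin m → A) (i : Fin m) →
                 ∃₂ λ P Q → tabulate f ≡ P ++ f i ∷ Q × (∀ {x} → x ∈ P → ∃[ j ] (j < i × x ≡ f j))
tabulate-split f zero    = [] , _ , refl , λ ()
tabulate-split f (suc i) with P , Q , eq , P<i ← tabulate-split (f ∘ suc) i =
  f zero ∷ P , Q , cong (f zero ∷_) eq , λ { (here refl) → zero , s≤s z≤n , refl
                                           ; (there x∈P) → let j , j<i , x≡ = P<i x∈P in suc j , s≤s j<i , x≡ }

module _ {A : Set} {P Q : A → Set} (P? : ∀ x → Dec (P x)) (Q? : ∀ x → Dec (Q x))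
         (P⇒Q : ∀ {x} → P x → Q x) where

  length-filter-mono : ∀ xs → length (filter P? xs) ℕ.≤ length (filter Q? xs)
  length-filter-mono []       = z≤n
  length-filter-mono (x ∷ xs) with P? x | Q? x
  ... | yes _ | yes _  = s≤s (length-filter-mono xs)
  ... | yes p | no ¬q  = contradiction (P⇒Q p) ¬q
  ... | no _  | yes _  = ℕ.m≤n⇒m≤1+n (length-filter-mono xs)
  ... | no _  | no _   = length-filter-mono xs

  length-filter-mono-< : ∀ {x} xs → x ∈ xs → ¬ P x → Q x → length (filter P? xs) ℕ.< length (filter Q? xs)
  length-filter-mono-< (y ∷ xs) (here refl) ¬p q with P? y | Q? y
  ... | yes p | _      = contradiction p ¬p
  ... | no _  | yes _  = s≤s (length-filter-mono xs)
  ... | no _  | no ¬q  = contradiction q ¬q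
  length-filter-mono-< (y ∷ xs) (there x∈xs) ¬p q with P? y | Q? y
  ... | yes _ | yes _  = s≤s (length-filter-mono-< xs x∈xs ¬p q)
  ... | yes p | no ¬q  = contradiction (P⇒Q p) ¬q
  ... | no _  | yes _  = ℕ.m<n⇒m<1+n (length-filter-mono-< xs x∈xs ¬p q)
  ... | no _  | no _   = length-filter-mono-< xs x∈xs ¬p q

injective⇒surjective : ∀ {n} {f : Fin n → Fin n} → Injective _≡_ _≡_ f → ∀ y → ∃[ x ] (f x ≡ y)
injective⇒surjective {suc n} {f} f-inj y with any? (λ x → f x ≟ y)
... | yes found = found
... | no missed = contradiction (injective⇒≤ punched-injective) ℕ.1+n≰n
  where
  y≢f : ∀ x → y ≢ f x
  y≢f x y≡fx = missed (x , sym y≡fx)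

  punched-injective : Injective _≡_ _≡_ (λ x → punchOut (y≢f x))
  punched-injective eq = f-inj (punchOut-injective (y≢f _) (y≢f _) eq)

injective⇒↔ : ∀ {n} {f : Fin n → Fin n} → Injective _≡_ _≡_ f → Fin n ↔ Fin n
injective⇒↔ {f = f} f-inj = mk↔ₛ′ f (proj₁ ∘ surj) (proj₂ ∘ surj) (λ x → f-inj (proj₂ (surj (f x))))
  where surj = injective⇒surjective f-inj

module _ {K : ℕ} (priority : Fin K → ℕ) where

  -- Lexicographic order on (priority x, x), encoded as a natural number.
  private
    key : Fin K → ℕ
    key x = toℕ x ℕ.+ priority x ℕ.* K

    key-mono : ∀ {x y} → priority x ℕ.< priority y → key x ℕ.< key y
    key-mono {x} {y} px<py = begin-strict
      toℕ x ℕ.+ priority x ℕ.* K  <⟨ ℕ.+-monoˡ-< (priority x ℕ.* K) (toℕ<n x) ⟩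
      suc (priority x) ℕ.* K      ≤⟨ ℕ.*-monoˡ-≤ K px<py ⟩
      priority y ℕ.* K            ≤⟨ ℕ.m≤n+m _ (toℕ y) ⟩
      key y                       ∎
      where open ℕ.≤-Reasoning

    key-injective : Injective _≡_ _≡_ key
    key-injective {x} {y} eq with <-cmp (priority x) (priority y)
    ... | tri< px<py _ _ = contradiction eq (ℕ.<⇒≢ (key-mono px<py))
    ... | tri> _ _ py<px = contradiction (sym eq) (ℕ.<⇒≢ (key-mono py<px))
    ... | tri≈ _ px≡py _ =
      toℕ-injective (ℕ.+-cancelʳ-≡ _ _ _ (subst (λ p → key x ≡ toℕ y ℕ.+ p ℕ.* K) (sym px≡py) eq))

    below : Fin K → List (Fin K)
    below x = filter (λ y → key y ℕ.<? key x) (allFin K)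

    length-below<K : ∀ x → length (below x) ℕ.< K
    length-below<K x = subst (length (below x) ℕ.<_) (length-tabulate {n = K} (λ i → i))
      (filter-notAll _ (allFin K) (Any.map (λ { refl → <-irrefl refl }) (∈-allFin x)))

    rank : Fin K → Fin K
    rank x = fromℕ< (length-below<K x)

    rank-mono : ∀ {x y} → key x ℕ.< key y → rank x < rank y
    rank-mono {x} {y} kx<ky = subst₂ ℕ._<_ (sym (toℕ-fromℕ< _)) (sym (toℕ-fromℕ< _))
      (length-filter-mono-< _ _ (λ kz<kx → ℕ.<-trans kz<kx kx<ky) (allFin K) (∈-allFin x) (<-irrefl refl) kx<ky)

    rank-injective : Injective _≡_ _≡_ rank
    rank-injective {x} {y} eq with <-cmp (key x) (key y)
    ... | tri< kx<ky _ _ = contradiction (cong toℕ eq) (ℕ.<⇒≢ (rank-mono kx<ky))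
    ... | tri≈ _ kx≡ky _ = key-injective kx≡ky
    ... | tri> _ _ ky<kx = contradiction (cong toℕ (sym eq)) (ℕ.<⇒≢ (rank-mono ky<kx))

  sortingPermutation : Σ[ π ∈ Fin K ↔ Fin K ]
                         (∀ {x y} → priority x ℕ.< priority y → Inverse.to π x < Inverse.to π y)
  sortingPermutation = injective⇒↔ rank-injective , rank-mono ∘ key-mono

module _ {K : ℕ} {E : Fin K → Fin K → Set} (E? : Decidable E) where

  data Walk : ℕ → Fin K → Set where
    []  : ∀ {x} → Walk 0 x
    _∷_ : ∀ {ℓ x y} → E x y → Walk ℓ y → Walk (suc ℓ) x

  private
    node : ∀ {ℓ x} → Walk ℓ x → Fin (suc ℓ) → Fin K
    node {x = x} w       zero    = x
    node         (e ∷ w) (suc i) = node w i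

    walk-from : ∀ {ℓ x y} → E x y → (w : Walk ℓ y) (j : Fin (suc ℓ)) → TransClosure E x (node w j)
    walk-from e w        zero    = [ e ]
    walk-from e (e' ∷ w) (suc j) = e ∷ walk-from e' w j

    walk-segment : ∀ {ℓ x} (w : Walk ℓ x) {i j} → i < j → TransClosure E (node w i) (node w j)
    walk-segment (e ∷ w) {zero}  {suc j} _         = walk-from e w j
    walk-segment (e ∷ w) {suc i} {suc j} (s≤s i<j) = walk-segment w i<j

  long-walk⇒cycle : ∀ {ℓ x} → K ℕ.≤ ℓ → Walk ℓ x → ∃[ y ] TransClosure E y y
  long-walk⇒cycle K≤ℓ w with i , j , i<j , same ← pigeonhole (s≤s K≤ℓ) (node w) =
    node w i , subst (TransClosure E (node w i)) (sym same) (walk-segment w i<j)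

  successors : Fin K → List (Fin K)
  successors x = filter (E? x) (allFin K)

  height : ℕ → Fin K → ℕ
  height zero    x = 0
  height (suc ℓ) x = max 0 (map (suc ∘ height ℓ) (successors x))

  height-≤ : ∀ ℓ x → height ℓ x ℕ.≤ ℓ
  height-≤ zero    x = z≤n
  height-≤ (suc ℓ) x = max≤v⁺ z≤n (All.map⁺ (All.universal (λ y → s≤s (height-≤ ℓ y)) (successors x)))

  height-edge : ∀ ℓ {x y} → E x y → suc (height ℓ y) ℕ.≤ height (suc ℓ) x
  height-edge ℓ {x} {y} e =
    v≤max⁺ 0 _ (inj₂ (Any.map⁺ (Any.map (λ { refl → ≤-refl }) (∈-filter⁺ (E? x) (∈-allFin y) e))))

  height-stable : ∀ ℓ x → ¬ Walk (suc ℓ) x → height (suc ℓ) x ≡ height ℓ x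
  height-stable zero    x no-walk = cong (max 0 ∘ map (ℕ.suc ∘ height 0))
    (filter-none (E? x) {xs = allFin K} (All.universal (λ y e → no-walk (e ∷ [])) (allFin K)))
  height-stable (suc ℓ) x no-walk = cong (max 0) (map-cong-local {xs = successors x} (All.tabulate λ y∈ →
    cong suc (height-stable ℓ _ λ w → no-walk (proj₂ (∈-filter⁻ (E? x) {xs = allFin K} y∈) ∷ w))))

  acyclic⇒height-decreasing : (∀ x → ¬ TransClosure E x x) →
                              ∀ {x y} → E x y → height (suc K) y ℕ.< height (suc K) x
  acyclic⇒height-decreasing acyclic {x} {y} e = subst (ℕ._< height (suc K) x)
    (sym (height-stable K y (λ w → let z , cycle = long-walk⇒cycle (ℕ.n≤1+n K) w in acyclic z cycle)))
    (height-edge K e)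

module _ {A : Set} {R : A → A → Set} where

  Star-▻⇒TransClosure : ∀ {x y z} → Star R x y → R y z → TransClosure R x z
  Star-▻⇒TransClosure ε        r' = [ r' ]
  Star-▻⇒TransClosure (r ◅ rs) r' = r ∷ Star-▻⇒TransClosure rs r'

  TransClosure⇒Star : ∀ {x y} → TransClosure R x y → Star R x y
  TransClosure⇒Star [ r ]    = r ◅ ε
  TransClosure⇒Star (r ∷ rs) = r ◅ TransClosure⇒Star rs

  record Chain (x y : A) : Set where
    field
      len   : ℕ
      node  : Fin (suc len) → A
      first : node zero ≡ x
      link  : ∀ i → R (node (inject₁ i)) (node (suc i))
      last  : node (fromℕ len) ≡ y

  Star⇒Chain : ∀ {x y} → Star R x y → Chain x y
  Star⇒Chain {x} ε        = record { len = 0 ; node = λ _ → x ; first = refl ; link = λ () ; last = refl }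
  Star⇒Chain {x} (r ◅ rs) = record { len = suc len ; node = node′ ; first = refl ; link = link′ ; last = last }
    where
    open Chain (Star⇒Chain rs)
    node′ : Fin (suc (suc len)) → A
    node′ zero    = x
    node′ (suc i) = node i
    link′ : ∀ i → R (node′ (inject₁ i)) (node′ (suc i))
    link′ zero    = subst (R x) (sym first) r
    link′ (suc i) = link i

module Sentential {Sg : Signature} (G : Grammar Sg) where

  record Expansion (s s' : Tm G) : Set where
    field
      pos    : Pos
      lhs    : NT G
      rhs    : Tm G
      rule   : (lhs , rhs) ∈ prods G
      at-pos : s at pos ≡ just (var lhs)
      result : s' ≡ replaceAt s pos rhs

  Step⇒Expansion : ∀ {s s'} → Step G s s' → Expansion s s'
  Step⇒Expansion (step p β r rule e) =
    record { pos = p ; lhs = β ; rhs = r ; rule = rule ; at-pos = e ; result = refl }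

  expand-occurrence : ∀ {s β r γ} → Occurs β s → (β , r) ∈ prods G → Occurs γ r →
                      ∃[ s' ] (Step G s s' × Occurs γ s')
  expand-occurrence {s} β∈s rule γ∈r with p , e ← Occurs⇒at β∈s =
    replaceAt s p _ , step p _ _ rule e , Occurs-replaceAt⁺ s p _ e γ∈r

  Edge : NT G → NT G → Set
  Edge β γ = ∃[ r ] ((β , r) ∈ prods G × Occurs γ r)

  Edge? : Decidable Edge
  Edge? β γ = map′ found (λ (r , rule , γ∈r) → lose rule (refl , γ∈r))
    (Any.any? (λ (β' , r) → (β' ≟ β) ×-dec occurs? _≟_ γ r) (prods G))
    where
    found : Any.Any (λ (β' , r) → β' ≡ β × Occurs γ r) (prods G) → Edge β γ
    found any with (β' , r) , rule , refl , γ∈r ← find any = r , rule , γ∈r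

  Derives : NT G → NT G → Set
  Derives β γ = ∃[ s ] (TransClosure (Step G) (var β) s × Occurs γ s)

  Reachable : NT G → Set
  Reachable γ = ∃[ s ] (Star (Step G) (var (start G)) s × Occurs γ s)

  Derives-edge : ∀ {β γ δ} → Derives β γ → Edge γ δ → Derives β δ
  Derives-edge (s , β⇒s , γ∈s) (r , rule , δ∈r) with s' , s⇒s' , δ∈s' ← expand-occurrence γ∈s rule δ∈r =
    s' , β⇒s ∷ʳ s⇒s' , δ∈s'

  Edge⁺⇒Derives : ∀ {β γ} → TransClosure Edge β γ → Derives β γ
  Edge⁺⇒Derives [ r , rule , γ∈r ] = r , [ step [] _ r rule refl ] , γ∈r
  Edge⁺⇒Derives (e ∷ es)          = extend (Edge⁺⇒Derives [ e ]) es
    where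
    extend : ∀ {β γ δ} → Derives β γ → TransClosure Edge γ δ → Derives β δ
    extend D [ e ]    = Derives-edge D e
    extend D (e ∷ es) = extend (Derives-edge D e) es

  Reachable-edge : ∀ {β γ} → Reachable β → Edge β γ → Derives (start G) γ
  Reachable-edge (s , τ⇒s , β∈s) (r , rule , γ∈r) with s' , s⇒s' , γ∈s' ← expand-occurrence β∈s rule γ∈r =
    s' , Star-▻⇒TransClosure τ⇒s s⇒s' , γ∈s'

  Reachable-successor : ∀ {β r γ} → Reachable β → (β , r) ∈ prods G → Occurs γ r → Reachable γ
  Reachable-successor rel rule γ∈r with s , τ⇒s , γ∈s ← Reachable-edge rel (_ , rule , γ∈r) =
    s , TransClosure⇒Star τ⇒s , γ∈s

module Enumeration {Sg : Signature} (G : Grammar Sg) (acyclic : Acyclic G) where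

  open Sentential G

  private
    K = k G
    τ = start G

    no-edge-cycle : ∀ β → ¬ TransClosure Edge β β
    no-edge-cycle β cycle with s , β⇒s , β∈s ← Edge⁺⇒Derives cycle = acyclic β s β⇒s β∈s

    h : NT G → ℕ
    h = height Edge? (suc K)

    -- Sorting by decreasing height alone would not put τ first: unreachable non-terminals may mention τ.
    priority : NT G → ℕ
    priority β with β ≟ τ
    ... | yes _ = 0
    ... | no _  = suc (suc K ∸ h β)

    priority-start : ∀ {β} → β ≢ τ → priority τ ℕ.< priority β
    priority-start {β} β≢τ with τ ≟ τ | β ≟ τ
    ... | yes _  | no _    = s≤s z≤n
    ... | no τ≢τ | _       = contradiction refl τ≢τ
    ... | _      | yes β≡τ = contradiction β≡τ β≢τ

    priority-edge : ∀ {β γ} → Reachable β → Edge β γ → priority β ℕ.< priority γ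
    priority-edge {β} {γ} rel e with β ≟ τ | γ ≟ τ
    ... | _     | yes γ≡τ = contradiction (Reachable-edge rel e) λ (s , τ⇒s , γ∈s) →
                              acyclic τ s τ⇒s (subst (λ x → Occurs x s) γ≡τ γ∈s)
    ... | yes _ | no _    = s≤s z≤n
    ... | no _  | no _    =
      s≤s (ℕ.∸-monoʳ-< (acyclic⇒height-decreasing Edge? no-edge-cycle e) (height-≤ Edge? (suc K) β))

    π : NT G ↔ Fin K
    π = proj₁ (sortingPermutation priority)

  index : NT G → Fin K
  index = Inverse.to π

  symbol : Fin K → NT G
  symbol = Inverse.from π

  index-symbol : ∀ i → index (symbol i) ≡ i
  index-symbol = Inverse.strictlyInverseˡ π

  symbol-index : ∀ β → symbol (index β) ≡ β
  symbol-index = Inverse.strictlyInverseʳ π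

  index-edge : ∀ {β r γ} → Reachable β → (β , r) ∈ prods G → Occurs γ r → index β < index γ
  index-edge rel rule γ∈r = proj₂ (sortingPermutation priority) (priority-edge rel (_ , rule , γ∈r))

  symbol-least : ∀ i → (∀ j → i ≤ j) → symbol i ≡ τ
  symbol-least i i-least with symbol i ≟ τ
  ... | yes iτ = iτ
  ... | no i≢τ = contradiction (i-least (index τ)) (ℕ.<⇒≱ (subst (index τ <_) (index-symbol i)
                   (proj₂ (sortingPermutation priority) (priority-start i≢τ))))

  index-induction : (P : NT G → Set) → (∀ β → (∀ γ → index β < index γ → P γ) → P β) → ∀ β → P β
  index-induction P ih = WF.All.wfRec (On.wellFounded index >-wellFounded) _ P (λ β ih′ → ih β (λ γ → ih′))

module Unfolding {Sg : Signature} (G : Grammar Sg) (acyclic : Acyclic G)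
                 (choice : NT G → Tm G) (choice-rule : ∀ β → (β , choice β) ∈ prods G) where

  open Sentential G
  open Enumeration G acyclic

  private
    τ = start G

  rules : List (NT G × Tm G)
  rules = tabulate (λ i → symbol i , choice (symbol i))

  unfold : NT G → Tm G
  unfold β = substSeq (var β) rules

  unfold-fixpoint : ∀ {β} → Reachable β → unfold β ≡ sub unfold (choice β)
  unfold-fixpoint {β} rel
    with A , B , split , A<β ← tabulate-split (λ i → symbol i , choice (symbol i)) (index β) = begin
    substSeq (var β) rules                        ≡⟨ cong (substSeq (var β)) rules≡ ⟩
    substSeq (var β) (A ++ (β , choice β) ∷ B)    ≡⟨ substSeq-var-unfold β (choice β) A B A#β A#choice β∉choice ⟩
    substSeq (choice β) (A ++ (β , choice β) ∷ B) ≡⟨ cong (substSeq (choice β)) rules≡ ⟨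
    substSeq (choice β) rules                     ≡⟨ substSeq≡sub (choice β) rules ⟩
    sub unfold (choice β)                         ∎
    where
    open ≡-Reasoning
    rules≡ : rules ≡ A ++ (β , choice β) ∷ B
    rules≡ = subst (λ γ → rules ≡ A ++ (γ , choice γ) ∷ B) (symbol-index β) split

    earlier : ∀ {b s} → (b , s) ∈ A → index b < index β
    earlier b∈A with j , j<β , refl ← A<β b∈A = subst (_< index β) (sym (index-symbol j)) j<β

    A#β : Fresh A (var β)
    A#β b∈A here = <-irrefl refl (earlier b∈A)

    A#choice : Fresh A (choice β)
    A#choice b∈A b∈choice = <-asym (earlier b∈A) (index-edge rel (choice-rule β) b∈choice)

    β∉choice : ¬ Occurs β (choice β)
    β∉choice β∈choice = <-irrefl refl (index-edge rel (choice-rule β) β∈choice)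

  unfold-ground : ∀ β → Reachable β → Ground (unfold β)
  unfold-ground = index-induction _ λ β ih rel →
    subst Ground (sym (unfold-fixpoint rel)) (Ground-sub unfold (choice β) λ γ γ∈ →
      ih γ (index-edge rel (choice-rule β) γ∈) (Reachable-successor rel (choice-rule β) γ∈))

  data ChosenStep (s : Tm G) : Tm G → Set where
    expand : ∀ p {β} → Reachable β → s at p ≡ just (var β) → ChosenStep s (replaceAt s p (choice β))

  data ChosenArgStep {m} (ss : Vec (Tm G) m) : Vec (Tm G) m → Set where
    expandArg : ∀ i p {β} → Reachable β → atArgs ss i p ≡ just (var β) →
                ChosenArgStep ss (replaceArgs ss i p (choice β))

  private
    under-fun : ∀ {f us vs} → ChosenArgStep us vs → ChosenStep (fun f us) (fun f vs)
    under-fun (expandArg i p rel e) = expand (i ∷ p) rel e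

    under-head : ∀ {m u v} {us : Vec (Tm G) m} → ChosenStep u v → ChosenArgStep (u ∷ us) (v ∷ us)
    under-head (expand p rel e) = expandArg zero p rel e

    under-tail : ∀ {m u} {us vs : Vec (Tm G) m} → ChosenArgStep us vs → ChosenArgStep (u ∷ us) (u ∷ vs)
    under-tail (expandArg i p rel e) = expandArg (suc i) p rel e

  mutual
    unfold-term⋆ : ∀ t → (∀ γ → Occurs γ t → Star ChosenStep (var γ) (unfold γ)) →
                   Star ChosenStep t (sub unfold t)
    unfold-term⋆ (var x)    h = h x here
    unfold-term⋆ (fun f ts) h = gmap (fun f) under-fun (unfold-args⋆ ts (λ γ → h γ ∘ under))

    unfold-args⋆ : ∀ {m} (ts : Vec (Tm G) m) → (∀ γ → OccursArgs γ ts → Star ChosenStep (var γ) (unfold γ)) →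
                   Star ChosenArgStep ts (subArgs unfold ts)
    unfold-args⋆ []       h = ε
    unfold-args⋆ (t ∷ ts) h = gmap (_∷ ts) under-head (unfold-term⋆ t (λ γ → h γ ∘ head))
                           ◅◅ gmap (sub unfold t ∷_) under-tail (unfold-args⋆ ts (λ γ → h γ ∘ tail))

  unfold⋆ : ∀ β → Reachable β → Star ChosenStep (var β) (unfold β)
  unfold⋆ = index-induction _ λ β ih rel →
    expand [] rel refl ◅ subst (Star ChosenStep (choice β)) (sym (unfold-fixpoint rel)) (unfold-term⋆ (choice β) λ γ γ∈ →
      ih γ (index-edge rel (choice-rule β) γ∈) (Reachable-successor rel (choice-rule β) γ∈))

  ChosenStep⇒Step : ∀ {s s'} → ChosenStep s s' → Step G s s'
  ChosenStep⇒Step (expand p rel e) = step p _ _ (choice-rule _) e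

  sub-unfold-invariant : ∀ {s s'} → ChosenStep s s' → sub unfold s' ≡ sub unfold s
  sub-unfold-invariant {s} (expand p rel e) = sub-replaceAt unfold s p _ e (sym (unfold-fixpoint rel))

  start-reachable : Reachable τ
  start-reachable = var τ , ε , here

  unfold-start∈L : L G (unfold τ)
  unfold-start∈L = unfold-ground τ start-reachable , derivation , rigid
    where
    open Chain (Star⇒Chain (unfold⋆ τ start-reachable))

    derivation : Derivation G (unfold τ)
    derivation =
      record { len = len ; terms = node ; initial = first ; steps = ChosenStep⇒Step ∘ link ; final = last }

    sub-unfold-node : ∀ i → sub unfold (node i) ≡ unfold τ
    sub-unfold-node = <-weakInduction (λ i → sub unfold (node i) ≡ unfold τ) (cong (sub unfold) first)
                        (λ i eq → trans (sub-unfold-invariant (link i)) eq)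

    at-unfold : ∀ i p {β} → node i at p ≡ just (var β) → unfold τ at p ≡ just (unfold β)
    at-unfold i p e = subst (λ u → u at p ≡ just _) (sub-unfold-node i) (at-sub unfold (node i) p e)

    rigid : TotallyRigid G derivation
    rigid i j p q β e e' = trans (at-unfold i p e) (sym (at-unfold j q e'))

module Extraction {Sg : Signature} (G : Grammar Sg) (acyclic : Acyclic G)
                  (productive : ∀ β → ∃[ r ] ((β , r) ∈ prods G))
                  {t : Tm G} (t-ground : Ground t) (d : Derivation G t) (rigid : TotallyRigid G d) where

  open Sentential G
  open Enumeration G acyclic
  open Derivation d

  private
    τ = start G

  expansion : (j : Fin len) → Expansion (terms (inject₁ j)) (terms (suc j))
  expansion j = Step⇒Expansion (steps j)

  Expanded : NT G → Set
  Expanded β = ∃[ j ] (Expansion.lhs (expansion j) ≡ β)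

  private
    expanded? : ∀ β → Dec (Expanded β)
    expanded? β = any? (λ j → Expansion.lhs (expansion j) ≟ β)

    pick : ∀ β → Dec (Expanded β) → ∃[ r ] ((β , r) ∈ prods G)
    pick β (yes (j , refl)) = Expansion.rhs (expansion j) , Expansion.rule (expansion j)
    pick β (no _)           = productive β

  choice : NT G → Tm G
  choice β = proj₁ (pick β (expanded? β))

  choice-rule : ∀ β → (β , choice β) ∈ prods G
  choice-rule β = proj₂ (pick β (expanded? β))

  choice-expanded : ∀ {β} → Expanded β →
                    ∃[ j ] (Expansion.lhs (expansion j) ≡ β × Expansion.rhs (expansion j) ≡ choice β)
  choice-expanded {β} ex with expanded? β
  ... | yes (j , refl) = j , refl , refl
  ... | no ¬ex         = contradiction ex ¬ex

  open Unfolding G acyclic choice choice-rule public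

  terms-reachable : ∀ i → Star (Step G) (var τ) (terms i)
  terms-reachable =
    <-weakInduction _ (subst (Star (Step G) (var τ)) (sym initial) ε) (λ i τ⇒ → τ⇒ ◅◅ (steps i ◅ ε))

  occurrence-reachable : ∀ i p {β} → terms i at p ≡ just (var β) → Reachable β
  occurrence-reachable i p e = terms i , terms-reachable i , at⇒Occurs (terms i) p e

  -- An occurrence that is never expanded survives into t, which is ground.
  occurrence-expanded : ∀ i p {β} → terms i at p ≡ just (var β) → Expanded β
  occurrence-expanded i p {β} e with expanded? β
  ... | yes ex = ex
  ... | no ¬ex = contradiction (at⇒Occurs t p (subst (λ u → u at p ≡ just (var β)) final survives)) (t-ground β)
    where
    OccursAtp : Fin (suc len) → Set
    OccursAtp j = terms j at p ≡ just (var β)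

    persists : ∀ j → OccursAtp (inject₁ j) → OccursAtp (suc j)
    persists j e' = subst (λ u → u at p ≡ just (var β)) (sym result)
      (replaceAt-preserves-var (terms (inject₁ j)) p pos rhs e' at-pos λ β≡lhs → ¬ex (j , sym β≡lhs))
      where open Expansion (expansion j)

    survives : OccursAtp (fromℕ len)
    survives = <-weakInduction-startingFrom OccursAtp e persists (≤fromℕ i)

  t-instance : ∀ i → t ≽ terms i
  t-instance = >-weakInduction (λ i → t ≽ terms i) (subst (t ≽_) (sym final) (≽-refl t)) λ j t≽ →
    let open Expansion (expansion j) in ≽-replaceAt⁻ (terms (inject₁ j)) pos rhs at-pos (subst (t ≽_) result t≽)

  At-unfold : NT G → Set
  At-unfold β = ∀ i p → terms i at p ≡ just (var β) → t at p ≡ just (unfold β)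

  module _ (j : Fin len) where
    open Expansion (expansion j)

    private
      rhs-at-pos : terms (suc j) at pos ≡ just rhs
      rhs-at-pos = subst (λ u → u at pos ≡ just rhs) (sym result) (at-replaceAt _ pos rhs at-pos)

    t-at-expansion : (∀ γ → Occurs γ rhs → At-unfold γ) → t at pos ≡ just (sub unfold rhs)
    t-at-expansion ih with w , t-at-pos , w≽rhs ← ≽-at pos (t-instance (suc j)) rhs-at-pos =
      trans t-at-pos (cong just (≽⇒≡sub unfold w≽rhs λ q γ e → begin
        w at q                   ≡⟨ at-++ t pos q t-at-pos ⟨
        t at (pos ++ q)          ≡⟨ ih γ (at⇒Occurs rhs q e) (suc j) (pos ++ q) (trans (at-++ _ pos q rhs-at-pos) e) ⟩
        just (unfold γ)          ∎))
      where open ≡-Reasoning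

  t-at-occurrence : ∀ β → At-unfold β
  t-at-occurrence = index-induction At-unfold λ β ih i p e →
    via-expansion β ih i p e (choice-expanded (occurrence-expanded i p e))
    where
    via-expansion : ∀ β → (∀ γ → index β < index γ → At-unfold γ) → ∀ i p → terms i at p ≡ just (var β) →
                    ∃[ j ] (Expansion.lhs (expansion j) ≡ β × Expansion.rhs (expansion j) ≡ choice β) →
                    t at p ≡ just (unfold β)
    via-expansion β ih i p e (j , refl , rhs≡choice) = begin
      t at p                        ≡⟨ rigid i (inject₁ j) p pos lhs e at-pos ⟩
      t at pos                      ≡⟨ t-at-expansion j (λ γ γ∈ → ih γ (index-edge rel rule γ∈)) ⟩
      just (sub unfold rhs)         ≡⟨ cong (just ∘ sub unfold) rhs≡choice ⟩
      just (sub unfold (choice lhs)) ≡⟨ cong just (unfold-fixpoint rel) ⟨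
      just (unfold lhs)             ∎
      where
      open ≡-Reasoning
      open Expansion (expansion j)
      rel = occurrence-reachable i p e

  t≡unfold : t ≡ unfold τ
  t≡unfold = just-injective (t-at-occurrence τ zero [] (cong just initial))

lemma1 : (Sg : Signature) (G : Grammar Sg) →
    Acyclic G →
    (∀ (β : NT G) → ∃[ r ] ((β , r) ∈ prods G)) →
    Σ[ n ∈ ℕ ] Σ[ α ∈ (Fin (suc n) ↔ NT G) ]
      ((Inverse.to α zero ≡ start G) ×
       (∀ (t : Tm G) →
         L G t ⇔
         (Σ[ ts ∈ (Fin (suc n) → Tm G) ]
           ((∀ i → (Inverse.to α i , ts i) ∈ prods G) ×
            (t ≡ substSeq (var (Inverse.to α zero))
                   (tabulate (λ i → (Inverse.to α i , ts i))))))))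
lemma1 Sg record { k = zero ; start = () }
lemma1 Sg G@record { k = suc n } acyclic productive =
  n , mk↔ₛ′ symbol index symbol-index index-symbol , symbol-zero , λ t → mk⇔ (L⇒unfolding t) (unfolding⇒L t)
  where
  open Enumeration G acyclic

  symbol-zero : symbol zero ≡ start G
  symbol-zero = symbol-least zero (λ _ → z≤n)

  Unfolds : Tm G → Set
  Unfolds t = Σ[ ts ∈ (Fin (suc n) → Tm G) ] ((∀ i → (symbol i , ts i) ∈ prods G) ×
                (t ≡ substSeq (var (symbol zero)) (tabulate (λ i → (symbol i , ts i)))))

  L⇒unfolding : ∀ t → L G t → Unfolds t
  L⇒unfolding t (ground , d , rigid) =
    choice ∘ symbol , choice-rule ∘ symbol , subst (λ β → t ≡ substSeq (var β) rules) (sym symbol-zero) t≡unfold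
    where open Extraction G acyclic productive ground d rigid

  unfolding⇒L : ∀ t → Unfolds t → L G t
  unfolding⇒L t (ts , ts-rule , t≡) = subst (L G) (sym (trans t≡ same-unfolding)) unfold-start∈L
    where
    choice : NT G → Tm G
    choice β = ts (index β)

    choice-rule : ∀ β → (β , choice β) ∈ prods G
    choice-rule β = subst (λ γ → (γ , choice β) ∈ prods G) (symbol-index β) (ts-rule (index β))

    open Unfolding G acyclic choice choice-rule

    same-unfolding : substSeq (var (symbol zero)) (tabulate (λ i → symbol i , ts i)) ≡ unfold (start G)
    same-unfolding = cong₂ (λ β rs → substSeq (var β) rs) symbol-zero
                       (tabulate-cong λ i → cong (λ j → symbol i , ts j) (sym (index-symbol i)))
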